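{- Let $p$ be an even positive integer and $\tau$ a non-negative integer. Let $\mu=\frac{p^2}{4}+2p+2$, $\gamma=2\mu-\left(\frac p2+4\right)$, $m=\mu+\tau\frac p2$, $g=\gamma+\tau(p-1)$, $c=p\mu+\tau\left(\frac{p^2}{2}-1\right)$, $S(p,\tau)=\langle m,g,g+1\rangle_c$ and $S(p)=S(p,0)$. Then $$\mathrm{E}(S(p,\tau))=\mathrm{E}(S(p))+\rho(S(p,\tau))=\frac p4\left(1-\frac p2\right)+\tau.$$
   Context: A numerical semigroup is a submonoid of $(\mathbb N,+)$ with finite complement. For integers $a_1,\dots,a_r$ and $t$, $\langle a_1,\dots,a_r\rangle_t$ denotes the smallest numerical semigroup containing $a_1,\dots,a_r$ and all integers $\ge t$. For a numerical semigroup $S$: conductor $c(S)$ is the smallest integer such that all integers $\ge c(S)$ are in $S$; multiplicity $m(S)$ is its least positive element; $L=\{s\in S: s<c(S)\}$; $P$ is the set of minimal generators; $q=\lceil c(S)/m(S)\rceil$; $\rho(S)=q\,m(S)-c(S)$; $I_q=\{z\in\mathbb Z: c(S)\le z<c(S)+m(S)\}$; $D_q=I_q\setminus P$. The Eliahou number is $\mathrm{E}(S)=|P\cap L|\,|L|-q\,|D_q|+\rho(S)$. -}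

module Defs where

open import Data.Nat using (ℕ; zero; suc; _+_; _*_; _∸_; _≤ᵇ_; _<ᵇ_; _≡ᵇ_; _/_)
open import Data.Bool using (Bool; true; false; _∧_; _∨_; not; if_then_else_)
open import Data.List using (List; []; _∷_; filter; length; upTo; map)
open import Data.Bool.ListAction using (any)
open import Data.Integer as ℤ using (ℤ)
open import Data.Bool.Properties using (T?)

-- Numerical semigroups are represented by a Boolean membership test
-- `mem : ℕ → Bool` together with a bound `t` such that every n ≥ t
-- belongs to the semigroup (so all invariants below are computed by
-- finite search in [0, t]).

range : ℕ → ℕ → List ℕ
range a b = map (λ i → a + i) (upTo (b ∸ a))

count : (ℕ → Bool) → List ℕ → ℕ
count P xs = length (filter (λ x → T? (P x)) xs)

-- Representability of n as a ℕ-linear combination of the elements of A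
-- (fuel-bounded; fuel n suffices as every positive generator reduces n by ≥ 1;
--  zero generators contribute nothing).
repF : List ℕ → ℕ → ℕ → Bool
repF A zero      n = n ≡ᵇ 0
repF A (suc f)   n = (n ≡ᵇ 0) ∨ any (λ a → (0 <ᵇ a) ∧ (a ≤ᵇ n) ∧ repF A f (n ∸ a)) A

Rep : List ℕ → ℕ → Bool
Rep A n = repF A n n

-- ⟨ A ⟩_t : the smallest numerical semigroup containing A and all
-- integers ≥ t, i.e. (ℕ-combinations of A) ∪ [t, ∞).
gen : List ℕ → ℕ → (ℕ → Bool)
gen A t n = (t ≤ᵇ n) ∨ Rep A n

-- conductor: least c such that every n ≥ c lies in S, computed as
-- 1 + (largest gap below k), scanning k = t (everything ≥ t is in S).
condBelow : (ℕ → Bool) → ℕ → ℕ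
condBelow mem zero    = zero
condBelow mem (suc k) = if mem k then condBelow mem k else suc k

conductor : (ℕ → Bool) → ℕ → ℕ
conductor mem t = condBelow mem t

first : (ℕ → Bool) → ℕ → List ℕ → ℕ
first P d []       = d
first P d (x ∷ xs) = if P x then x else first P d xs

-- multiplicity: least positive element (t+1 is always in S)
multiplicity : (ℕ → Bool) → ℕ → ℕ
multiplicity mem t = first mem (suc t) (range 1 (suc t))

-- ⌈ a / b ⌉ for b ≥ 1: least k with a ≤ k * b (k = a works when b ≥ 1)
ceilDiv : ℕ → ℕ → ℕ
ceilDiv a b = first (λ k → a ≤ᵇ k * b) a (upTo (suc a))

isMinGen : (ℕ → Bool) → ℕ → Bool
isMinGen mem n = mem n ∧ (0 <ᵇ n) ∧
  not (any (λ k → mem k ∧ mem (n ∸ k)) (range 1 n))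

module _ (mem : ℕ → Bool) (t : ℕ) where
  cS : ℕ
  cS = conductor mem t

  mS : ℕ
  mS = multiplicity mem t

  qS : ℕ
  qS = ceilDiv cS mS

  ρS : ℤ
  ρS = ℤ.+ (qS * mS) ℤ.- ℤ.+ cS

  cardL : ℕ
  cardL = count mem (range 0 cS)

  cardPL : ℕ
  cardPL = count (isMinGen mem) (range 0 cS)

  cardDq : ℕ
  cardDq = count (λ z → not (isMinGen mem z)) (range cS (cS + mS))

  Eliahou : ℤ
  Eliahou = (ℤ.+ (cardPL * cardL) ℤ.- ℤ.+ (qS * cardDq)) ℤ.+ ρS

module Family (p τ : ℕ) where
  h : ℕ
  h = p / 2

  μ : ℕ
  μ = h * h + 2 * p + 2

  γ : ℕ
  γ = 2 * μ ∸ (h + 4)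

  mm : ℕ
  mm = μ + τ * h

  gg : ℕ
  gg = γ + τ * (p ∸ 1)

  cc : ℕ
  cc = p * μ + τ * (2 * (h * h) ∸ 1)

  gens : List ℕ
  gens = mm ∷ gg ∷ suc gg ∷ []

Smem : ℕ → ℕ → (ℕ → Bool)
Smem p τ = gen (Family.gens p τ) (Family.cc p τ)

Sbound : ℕ → ℕ → ℕ
Sbound p τ = Family.cc p τ

E-S : ℕ → ℕ → ℤ
E-S p τ = Eliahou (Smem p τ) (Sbound p τ)

ρ-S : ℕ → ℕ → ℤ
ρ-S p τ = ρS (Smem p τ) (Sbound p τ)

module Submission where

-- Write p = 2h and D = h + 4 + τ, so that m = hD + 2, g = 2m − D and c = 2hm − τ.  Every
-- element of ⟨m, g, g + 1⟩ is a m + B g + y with y ≤ B, and for 1 ≤ B ≤ h it lies in the block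
-- [km, (k + 1)m) with k = a + 2B − 1, at a residue in [(h − B)D + 2, (h − B)D + 2 + B]; h + 1
-- copies of g give one more interval in block 2h, and more copies overshoot it.  So below c the
-- block k consists of 0 and the intervals with B ≤ ⌈k/2⌉, hence has T(⌈k/2⌉ + 1) elements
-- (T the triangular numbers); c − 1 is a gap and m, g, g + 1 are the minimal generators below c.
-- In [c, c + m) the first τ numbers are gaps of block 2h − 1 and the rest is the start of block
-- 2h.  Thus |L|, |P ∩ L| = 3, q = 2h and |D_q| = T(h + 1) + h + 2 do not depend on τ, while
-- ρ = τ, and E is a polynomial in h plus τ.

open import Defs
open import Data.Nat using (ℕ; _<_; _/_)
open import Data.Nat.Divisibility using (_∣_)
open import Data.Integer as ℤ using (ℤ; +_)
open import Data.Product using (_×_)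
open import Relation.Binary.PropositionalEquality using (_≡_)

open import Data.Bool using (Bool; true; false; T; not; _∧_; _∨_; if_then_else_)
open import Data.Bool.Properties using (T-∧; T-∨; not-involutive)
open import Data.Bool.ListAction using (any)
open import Data.Empty using (⊥-elim)
import Data.Integer.Properties as ℤP
import Data.Integer.Tactic.RingSolver as ℤSolver
open import Data.List using (List; []; _∷_; applyUpTo)
open import Data.List.Properties using (map-upTo)
open import Data.List.Membership.Propositional using (_∈_; find; lose)
open import Data.List.Membership.Propositional.Properties using (∈-applyUpTo⁺; ∈-applyUpTo⁻)
open import Data.List.Relation.Unary.Any using (here; there)
open import Data.List.Relation.Unary.Any.Properties using (any⁺; any⁻)
open import Data.Nat
open import Data.Nat.DivMod using (_%_; [m+kn]%n≡m%n; m<n⇒m%n≡m; m*n/n≡m)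
open import Data.Nat.Divisibility using (divides)
open import Data.Nat.Properties
open import Algebra.Properties.CommutativeSemigroup +-commutativeSemigroup using (interchange)
open import Data.Nat.Tactic.RingSolver using (solve; solve-∀)
open import Data.Product using (∃-syntax; _,_; proj₁; proj₂)
open import Data.Sum using (_⊎_; inj₁; inj₂)
open import Data.Unit using (tt)
open import Function using (_∘_; _⇔_; mk⇔; Equivalence)
open import Relation.Binary.PropositionalEquality
open import Relation.Nullary using (¬_; contradiction; yes; no)

open Equivalence using (to; from)

T⇒≡true : ∀ {b} → T b → b ≡ true
T⇒≡true {true} _ = refl

¬T⇒≡false : ∀ {b} → ¬ T b → b ≡ false
¬T⇒≡false {false} _  = refl
¬T⇒≡false {true}  ¬t = contradiction tt ¬t

T-⇔⇒≡ : ∀ {a b} → T a ⇔ T b → a ≡ b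
T-⇔⇒≡ {false} {false} _ = refl
T-⇔⇒≡ {false} {true}  e = ⊥-elim (from e tt)
T-⇔⇒≡ {true}  {false} e = ⊥-elim (to e tt)
T-⇔⇒≡ {true}  {true}  _ = refl

≡⇒T⇔ : ∀ {a b} → a ≡ b → T a ⇔ T b
≡⇒T⇔ refl = mk⇔ (λ t → t) (λ t → t)

countUpTo : (ℕ → Bool) → ℕ → ℕ
countUpTo P zero    = 0
countUpTo P (suc n) = (if P 0 then 1 else 0) + countUpTo (P ∘ suc) n

count-applyUpTo : ∀ P (f : ℕ → ℕ) n → count P (applyUpTo f n) ≡ countUpTo (P ∘ f) n
count-applyUpTo P f zero = refl
count-applyUpTo P f (suc n) with P (f 0)
... | true  = cong suc (count-applyUpTo P (f ∘ suc) n)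
... | false = count-applyUpTo P (f ∘ suc) n

count-range : ∀ P a b → count P (range a b) ≡ countUpTo (λ i → P (a + i)) (b ∸ a)
count-range P a b =
  trans (cong (count P) (map-upTo (λ i → a + i) (b ∸ a))) (count-applyUpTo P (λ i → a + i) (b ∸ a))

countUpTo-cong : ∀ {P Q} n → (∀ i → i < n → T (P i) ⇔ T (Q i)) → countUpTo P n ≡ countUpTo Q n
countUpTo-cong zero    _  = refl
countUpTo-cong (suc n) eq =
  cong₂ _+_ (cong (if_then 1 else 0) (T-⇔⇒≡ (eq 0 z<s)))
            (countUpTo-cong n (λ i i<n → eq (suc i) (s<s i<n)))

countUpTo-+ : ∀ P m n → countUpTo P (m + n) ≡ countUpTo P m + countUpTo (λ i → P (m + i)) n
countUpTo-+ P zero    n = refl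
countUpTo-+ P (suc m) n =
  trans (cong (λ x → (if P 0 then 1 else 0) + x) (countUpTo-+ (P ∘ suc) m n))
        (sym (+-assoc (if P 0 then 1 else 0) _ _))

countUpTo-none : ∀ P n → (∀ i → i < n → ¬ T (P i)) → countUpTo P n ≡ 0
countUpTo-none P zero    _    = refl
countUpTo-none P (suc n) none rewrite ¬T⇒≡false (none 0 z<s) =
  countUpTo-none (P ∘ suc) n (λ i i<n → none (suc i) (s<s i<n))

countUpTo-all : ∀ P n → (∀ i → i < n → T (P i)) → countUpTo P n ≡ n
countUpTo-all P zero    _   = refl
countUpTo-all P (suc n) all rewrite T⇒≡true (all 0 z<s) =
  cong suc (countUpTo-all (P ∘ suc) n (λ i i<n → all (suc i) (s<s i<n)))

countUpTo-∨ : ∀ P Q n → (∀ i → i < n → T (P i) → ¬ T (Q i)) →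
              countUpTo (λ i → P i ∨ Q i) n ≡ countUpTo P n + countUpTo Q n
countUpTo-∨ P Q zero    _        = refl
countUpTo-∨ P Q (suc n) disjoint =
  trans (cong₂ _+_ (head (P 0) (Q 0) (disjoint 0 z<s))
                   (countUpTo-∨ (P ∘ suc) (Q ∘ suc) n (λ i i<n → disjoint (suc i) (s<s i<n))))
        (interchange (if P 0 then 1 else 0) (if Q 0 then 1 else 0) _ _)
  where
  head : ∀ a b → (T a → ¬ T b) →
         (if a ∨ b then 1 else 0) ≡ (if a then 1 else 0) + (if b then 1 else 0)
  head true  b ab rewrite ¬T⇒≡false (ab tt) = refl
  head false b _  = refl

inInterval : ℕ → ℕ → ℕ → Bool
inInterval lo len r = (lo ≤ᵇ r) ∧ (r ≤ᵇ lo + len)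

T-inInterval : ∀ {lo len r} → T (inInterval lo len r) ⇔ (lo ≤ r × r ≤ lo + len)
T-inInterval {lo} {len} {r} = mk⇔
  (λ t → let (p , q) = to T-∧ t in ≤ᵇ⇒≤ lo r p , ≤ᵇ⇒≤ r (lo + len) q)
  (λ (p , q) → from T-∧ (≤⇒≤ᵇ p , ≤⇒≤ᵇ q))

countUpTo-inInterval : ∀ lo len N → lo + len < N → countUpTo (inInterval lo len) N ≡ suc len
countUpTo-inInterval lo len N lt = begin
  countUpTo I N
    ≡⟨ cong (countUpTo I) (sym N≡) ⟩
  countUpTo I (lo + (suc len + k))
    ≡⟨ countUpTo-+ I lo (suc len + k) ⟩
  countUpTo I lo + countUpTo (λ i → I (lo + i)) (suc len + k)
    ≡⟨ cong (λ x → countUpTo I lo + x) (countUpTo-+ (λ i → I (lo + i)) (suc len) k) ⟩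
  countUpTo I lo + (countUpTo (λ i → I (lo + i)) (suc len) + countUpTo (λ i → I (lo + (suc len + i))) k)
    ≡⟨ cong₂ (λ x y → x + (y + countUpTo (λ i → I (lo + (suc len + i))) k)) before inside ⟩
  suc len + countUpTo (λ i → I (lo + (suc len + i))) k
    ≡⟨ cong (λ x → suc len + x) after ⟩
  suc len + 0
    ≡⟨ +-identityʳ (suc len) ⟩
  suc len ∎
  where
  open ≡-Reasoning
  I : ℕ → Bool
  I = inInterval lo len
  k : ℕ
  k = N ∸ suc (lo + len)
  N≡ : lo + (suc len + k) ≡ N
  N≡ = trans (sym (+-assoc lo (suc len) k))
             (trans (cong (_+ k) (+-suc lo len)) (m+[n∸m]≡n lt))
  before : countUpTo I lo ≡ 0
  before = countUpTo-none I lo (λ i i<lo → <⇒≱ i<lo ∘ proj₁ ∘ to (T-inInterval {lo} {len} {i}))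
  inside : countUpTo (λ i → I (lo + i)) (suc len) ≡ suc len
  inside = countUpTo-all _ (suc len)
    (λ i i≤len → from T-inInterval (m≤m+n lo i , +-monoʳ-≤ lo (≤-pred i≤len)))
  after : countUpTo (λ i → I (lo + (suc len + i))) k ≡ 0
  after = countUpTo-none _ k (λ i _ t →
    let (_ , above) = to (T-inInterval {lo} {len} {lo + (suc len + i)}) t in
    <⇒≱ (≤-trans (≤-reflexive (sym (+-suc lo len))) (+-monoʳ-≤ lo (m≤m+n (suc len) i))) above)

first-applyUpTo : ∀ P d (f : ℕ → ℕ) n k → k < n → (∀ i → i < k → ¬ T (P (f i))) → T (P (f k)) →
                  first P d (applyUpTo f n) ≡ f k
first-applyUpTo P d f (suc n) zero    _         _      Pk rewrite T⇒≡true Pk = refl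
first-applyUpTo P d f (suc n) (suc k) (s<s k<n) before Pk rewrite ¬T⇒≡false (before 0 z<s) =
  first-applyUpTo P d (f ∘ suc) n k k<n (λ i i<k → before (suc i) (s<s i<k)) Pk

ceilDiv-≡ : ∀ c m k → 0 < m → k * m < c → c ≤ suc k * m → ceilDiv c m ≡ suc k
ceilDiv-≡ c m@(suc _) k _ below above =
  first-applyUpTo (λ i → c ≤ᵇ i * m) c (λ i → i) (suc c) (suc k)
    (s<s (≤-<-trans (m≤m*n k m) below))
    (λ i i≤k t → <⇒≱ (≤-<-trans (*-monoˡ-≤ m (≤-pred i≤k)) below) (≤ᵇ⇒≤ c (i * m) t))
    (≤⇒≤ᵇ above)

conductor-≡ : ∀ mem f → ¬ T (mem f) → conductor mem (suc f) ≡ suc f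
conductor-≡ mem f gap rewrite ¬T⇒≡false gap = refl

multiplicity-≡ : ∀ mem t m → 0 < m → m ≤ t → T (mem m) → (∀ i → 0 < i → i < m → ¬ T (mem i)) →
                 multiplicity mem t ≡ m
multiplicity-≡ mem t (suc k) _ m≤t mem-m gaps =
  trans (cong (first mem (suc t)) (map-upTo suc t))
        (first-applyUpTo mem (suc t) suc t k m≤t (λ i i<k → gaps (suc i) z<s (s<s i<k)) mem-m)

T-any-range : ∀ P a b → T (any P (range a b)) ⇔ (∃[ i ] a ≤ i × i < b × T (P i))
T-any-range P a b = mk⇔ to′ from′
  where
  range≡ : range a b ≡ applyUpTo (λ i → a + i) (b ∸ a)
  range≡ = map-upTo (λ i → a + i) (b ∸ a)
  to′ : T (any P (range a b)) → ∃[ i ] a ≤ i × i < b × T (P i)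
  to′ t with find (any⁻ P (applyUpTo (λ i → a + i) (b ∸ a)) (subst (T ∘ any P) range≡ t))
  ... | x , x∈ , Px with ∈-applyUpTo⁻ (λ i → a + i) x∈
  ...   | i , i<b∸a , refl =
    a + i , m≤m+n a i , a+i<b , Px
    where
    a+i<b : a + i < b
    a+i<b = subst (a + i <_) (m+[n∸m]≡n {a} {b} (<⇒≤ (m∸n≢0⇒n<m (λ e → n≮0 (subst (i <_) e i<b∸a)))))
                  (+-monoʳ-< a i<b∸a)
  from′ : ∃[ i ] a ≤ i × i < b × T (P i) → T (any P (range a b))
  from′ (i , a≤i , i<b , Pi) = subst (T ∘ any P) (sym range≡)
    (any⁺ P (lose (subst (_∈ applyUpTo (λ i → a + i) (b ∸ a)) (m+[n∸m]≡n a≤i)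
                     (∈-applyUpTo⁺ (λ i → a + i) (∸-monoˡ-< i<b a≤i)))
                  Pi))

data Combination (A : List ℕ) : ℕ → Set where
  []  : Combination A 0
  _∷_ : ∀ {a n} → a ∈ A → Combination A n → Combination A (a + n)

Combination-+ : ∀ {A m n} → Combination A m → Combination A n → Combination A (m + n)
Combination-+ []                   c = c
Combination-+ (_∷_ {a} {n} a∈ c′) c = subst (Combination _) (sym (+-assoc a n _)) (a∈ ∷ Combination-+ c′ c)

Combination-≥ : ∀ {A m n} → (∀ {a} → a ∈ A → m ≤ a) → Combination A n → n ≡ 0 ⊎ m ≤ n
Combination-≥ m≤A []                  = inj₁ refl
Combination-≥ m≤A (_∷_ {a} {n} a∈ _) = inj₂ (≤-trans (m≤A a∈) (m≤m+n a n))

repF-sound : ∀ A f n → T (repF A f n) → Combination A n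
repF-sound A zero    n t rewrite ≡ᵇ⇒≡ n 0 t = []
repF-sound A (suc f) n t with to T-∨ t
... | inj₁ n≡0 rewrite ≡ᵇ⇒≡ n 0 n≡0 = []
... | inj₂ step with find (any⁻ _ A step)
...   | a , a∈ , t′ =
  let (_ , rest) = to (T-∧ {0 <ᵇ a}) t′
      (a≤n , rep) = to T-∧ rest
  in subst (Combination A) (m+[n∸m]≡n (≤ᵇ⇒≤ a n a≤n)) (a∈ ∷ repF-sound A f (n ∸ a) rep)

repF-complete : ∀ {A n} f → Combination A n → n ≤ f → T (repF A f n)
repF-complete zero    []                     _ = tt
repF-complete (suc f) []                     _ = tt
repF-complete f       (_∷_ {zero}  _  c)     n≤f = repF-complete f c n≤f
repF-complete (suc f) (_∷_ {suc a} {n} a∈ c) a+n≤f =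
  any⁺ _ (lose a∈ (from T-∧ (tt , from T-∧ (≤⇒≤ᵇ (m≤m+n (suc a) n) ,
    subst (T ∘ repF _ f) (sym (m+n∸m≡n (suc a) n))
          (repF-complete f c (≤-trans (m≤n+m n a) (≤-pred a+n≤f)))))))

Rep-sound : ∀ {A n} → T (Rep A n) → Combination A n
Rep-sound {A} {n} = repF-sound A n n

Rep-complete : ∀ {A n} → Combination A n → T (Rep A n)
Rep-complete {n = n} c = repF-complete n c ≤-refl

Splits : (ℕ → Bool) → ℕ → Set
Splits mem n = ∃[ k ] 0 < k × k < n × T (mem k) × T (mem (n ∸ k))

T-any-splits : ∀ mem n → T (any (λ k → mem k ∧ mem (n ∸ k)) (range 1 n)) ⇔ Splits mem n
T-any-splits mem n = mk⇔
  (λ t → let (k , 0<k , k<n , both) = to (T-any-range _ 1 n) t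
             (mem-k , mem-n∸k) = to T-∧ both
         in k , 0<k , k<n , mem-k , mem-n∸k)
  (λ (k , 0<k , k<n , mem-k , mem-n∸k) → from (T-any-range _ 1 n) (k , 0<k , k<n , from T-∧ (mem-k , mem-n∸k)))

T-isMinGen : ∀ mem n → T (isMinGen mem n) ⇔ (T (mem n) × 0 < n × ¬ Splits mem n)
T-isMinGen mem n = mk⇔
  (λ t → let (mem-n , rest) = to T-∧ t
             (0<n , unsplit) = to T-∧ rest
         in mem-n , <ᵇ⇒< 0 n 0<n , λ s → T-not unsplit (from (T-any-splits mem n) s))
  (λ (mem-n , 0<n , unsplit) → from T-∧ (mem-n , from T-∧ (<⇒<ᵇ 0<n ,
     ¬T-not (λ t → unsplit (to (T-any-splits mem n) t)))))
  where
  T-not : ∀ {b} → T (not b) → ¬ T b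
  T-not {false} _ ()
  ¬T-not : ∀ {b} → ¬ T b → T (not b)
  ¬T-not {false} _ = tt
  ¬T-not {true}  ¬t = ¬t tt

T-not-isMinGen : ∀ mem n → T (mem n) → 0 < n → T (not (isMinGen mem n)) ⇔ Splits mem n
T-not-isMinGen mem n mem-n 0<n
  rewrite T⇒≡true mem-n | T⇒≡true (<⇒<ᵇ 0<n)
        | not-involutive (any (λ k → mem k ∧ mem (n ∸ k)) (range 1 n)) = T-any-splits mem n

module GeneratedSemigroup (A : List ℕ) (t m : ℕ) (0<m : 0 < m) (m≤t : m ≤ t)
                          (m≤A : ∀ {a} → a ∈ A → m ≤ a) where

  S : ℕ → Bool
  S = gen A t

  S≡Rep-below : ∀ {n} → n < t → S n ≡ Rep A n
  S≡Rep-below {n} n<t rewrite ¬T⇒≡false (<⇒≱ n<t ∘ ≤ᵇ⇒≤ t n) = refl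

  T-S-below : ∀ {n} → n < t → T (S n) ⇔ Combination A n
  T-S-below n<t rewrite S≡Rep-below n<t = mk⇔ Rep-sound Rep-complete

  S-above : ∀ {n} → t ≤ n → T (S n)
  S-above t≤n = from T-∨ (inj₁ (≤⇒≤ᵇ t≤n))

  Combination⇒S : ∀ {n} → Combination A n → T (S n)
  Combination⇒S c = from T-∨ (inj₂ (Rep-complete c))

  S-≥m : ∀ {n} → 0 < n → T (S n) → m ≤ n
  S-≥m {n} 0<n Sn with n <? t
  ... | no  n≮t = ≤-trans m≤t (≮⇒≥ n≮t)
  ... | yes n<t with Combination-≥ m≤A (to (T-S-below n<t) Sn)
  ...   | inj₁ refl = contradiction 0<n (<-irrefl refl)
  ...   | inj₂ m≤n  = m≤n

  generator∈S : ∀ {a} → a ∈ A → T (S a)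
  generator∈S {a} a∈ = Combination⇒S (subst (Combination A) (+-identityʳ a) (a∈ ∷ []))

  multiplicity-S : m ∈ A → multiplicity S t ≡ m
  multiplicity-S m∈A = multiplicity-≡ S t m 0<m m≤t (generator∈S m∈A)
    (λ i 0<i i<m Si → <⇒≱ i<m (S-≥m 0<i Si))

  isMinGen⇔∈ : (∀ {a} → a ∈ A → a < m + m) → ∀ {n} → n < t → T (isMinGen S n) ⇔ n ∈ A
  isMinGen⇔∈ A<2m {n} n<t = mk⇔ minimal⇒∈ ∈⇒minimal
    where
    minimal⇒∈ : T (isMinGen S n) → n ∈ A
    minimal⇒∈ t′ with to (T-isMinGen S n) t′
    ... | Sn , 0<n , unsplit with to (T-S-below n<t) Sn
    ...   | [] = contradiction 0<n (<-irrefl refl)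
    ...   | _∷_ {a} {r} a∈ c with Combination-≥ m≤A c
    ...     | inj₁ refl = subst (_∈ A) (sym (+-identityʳ a)) a∈
    ...     | inj₂ m≤r  = contradiction
      (a , <-≤-trans 0<m (m≤A a∈) , m<m+n a (<-≤-trans 0<m m≤r) , generator∈S a∈ ,
       subst (T ∘ S) (sym (m+n∸m≡n a r)) (Combination⇒S c)) unsplit
    ∈⇒minimal : n ∈ A → T (isMinGen S n)
    ∈⇒minimal n∈A = from (T-isMinGen S n)
      ( generator∈S n∈A
      , <-≤-trans 0<m (m≤A n∈A)
      , λ (k , 0<k , k<n , Sk , Sn∸k) →
          <⇒≱ (A<2m n∈A)
              (≤-trans (+-mono-≤ (S-≥m 0<k Sk) (S-≥m (m<n⇒0<n∸m k<n) Sn∸k))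
                       (≤-reflexive (m+[n∸m]≡n (<⇒≤ k<n)))) )

  module AboveConductor (A<t : ∀ {a} → a ∈ A → a < t) where

    Combination⇒Splits : ∀ {z} → t ≤ z → Combination A z → Splits S z
    Combination⇒Splits t≤0 [] = contradiction (<-≤-trans 0<m (≤-trans m≤t t≤0)) (<-irrefl refl)
    Combination⇒Splits {z} t≤z (_∷_ {a} {r} a∈ c) =
      a , <-≤-trans 0<m (m≤A a∈) , m<m+n a 0<r , generator∈S a∈ ,
      subst (T ∘ S) (sym (m+n∸m≡n a r)) (Combination⇒S c)
      where
      0<r : 0 < r
      0<r = ≰⇒> λ r≤0 →
        <⇒≱ (A<t a∈) (≤-trans t≤z (≤-trans (+-monoʳ-≤ a r≤0) (≤-reflexive (+-identityʳ a))))

    -- In a splitting of z < t + m, a summand x ≥ t would leave a positive element y < m.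
    summand<t : ∀ {z x y} → z < t + m → x + y ≡ z → 0 < y → T (S y) → x < t
    summand<t {z} {x} {y} z<t+m e 0<y Sy = ≰⇒> λ t≤x →
      <⇒≱ (+-cancelˡ-< t y m (≤-<-trans (+-monoˡ-≤ y t≤x) (subst (_< t + m) (sym e) z<t+m))) (S-≥m 0<y Sy)

    Splits⇒Combination : ∀ {z} → z < t + m → Splits S z → Combination A z
    Splits⇒Combination {z} z<t+m (k , 0<k , k<z , Sk , Sz∸k) =
      subst (Combination A) k+z∸k (Combination-+ (to (T-S-below k<t) Sk) (to (T-S-below z∸k<t) Sz∸k))
      where
      k+z∸k : k + (z ∸ k) ≡ z
      k+z∸k = m+[n∸m]≡n (<⇒≤ k<z)
      k<t : k < t
      k<t = summand<t z<t+m k+z∸k (m<n⇒0<n∸m k<z) Sz∸k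
      z∸k<t : z ∸ k < t
      z∸k<t = summand<t z<t+m (trans (+-comm (z ∸ k) k) k+z∸k) 0<k Sk

    notMinGen⇔Combination : ∀ {z} → t ≤ z → z < t + m → T (not (isMinGen S z)) ⇔ Combination A z
    notMinGen⇔Combination {z} t≤z z<t+m = mk⇔
      (Splits⇒Combination z<t+m ∘ to splits) (from splits ∘ Combination⇒Splits t≤z)
      where
      splits : T (not (isMinGen S z)) ⇔ Splits S z
      splits = T-not-isMinGen S z (S-above t≤z) (<-≤-trans 0<m (≤-trans m≤t t≤z))

quotient-unique : ∀ {M} .{{_ : NonZero M}} q r q′ r′ → r < M → r′ < M →
                  q * M + r ≡ q′ * M + r′ → q ≡ q′ × r ≡ r′
quotient-unique {M} q r q′ r′ r<M r′<M e =
  *-cancelʳ-≡ q q′ M (+-cancelʳ-≡ r (q * M) (q′ * M) (trans e (cong (λ x → q′ * M + x) (sym r≡r′))))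
  , r≡r′
  where
  remainder : ∀ q r → r < M → (q * M + r) % M ≡ r
  remainder q r r<M =
    trans (cong (_% M) (+-comm (q * M) r)) (trans ([m+kn]%n≡m%n r q M) (m<n⇒m%n≡m r<M))
  r≡r′ : r ≡ r′
  r≡r′ = trans (sym (remainder q r r<M)) (trans (cong (_% M) e) (remainder q′ r′ r′<M))

double-suc : ∀ n → 2 * suc n ≡ suc (suc (2 * n))
double-suc = solve-∀

half-≤ : ∀ {B β} → 2 * B ≤ suc (2 * β) → B ≤ β
half-≤ {B} {β} 2B≤ = ≮⇒≥ λ β<B →
  1+n≰n (≤-trans (≤-reflexive (sym (double-suc β))) (≤-trans (*-monoʳ-≤ 2 β<B) 2B≤))

split-at : ∀ {L B r} → L ≤ r → r ≤ L + B → ∃[ y ] r ≡ L + y × y ≤ B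
split-at {L} {B} {r} L≤r r≤ =
  r ∸ L , sym (m+[n∸m]≡n L≤r) , ≤-trans (∸-monoˡ-≤ L r≤) (≤-reflexive (m+n∸m≡n L B))

module ThreeGenerators (M G : ℕ) where

  gens : List ℕ
  gens = M ∷ G ∷ suc G ∷ []

  Combination⇒normalForm : ∀ {n} → Combination gens n →
                           ∃[ a ] ∃[ B ] ∃[ y ] y ≤ B × n ≡ a * M + B * G + y
  Combination⇒normalForm [] = 0 , 0 , 0 , z≤n , refl
  Combination⇒normalForm (here refl ∷ c) with Combination⇒normalForm c
  ... | a , B , y , y≤B , refl = suc a , B , y , y≤B , solve (a ∷ B ∷ y ∷ M ∷ G ∷ [])
  Combination⇒normalForm (there (here refl) ∷ c) with Combination⇒normalForm c
  ... | a , B , y , y≤B , refl = a , suc B , y , m≤n⇒m≤1+n y≤B , solve (a ∷ B ∷ y ∷ M ∷ G ∷ [])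
  Combination⇒normalForm (there (there (here refl)) ∷ c) with Combination⇒normalForm c
  ... | a , B , y , y≤B , refl = a , suc B , suc y , s≤s y≤B , solve (a ∷ B ∷ y ∷ M ∷ G ∷ [])

  normalForm⇒Combination : ∀ a B y → y ≤ B → Combination gens (a * M + B * G + y)
  normalForm⇒Combination (suc a) B y y≤B =
    subst (Combination gens) add-M (here refl ∷ normalForm⇒Combination a B y y≤B)
    where
    add-M : M + (a * M + B * G + y) ≡ suc a * M + B * G + y
    add-M = solve (a ∷ B ∷ y ∷ M ∷ G ∷ [])
  normalForm⇒Combination zero zero zero z≤n = []
  normalForm⇒Combination zero (suc B) zero z≤n =
    subst (Combination gens) add-G (there (here refl) ∷ normalForm⇒Combination zero B zero z≤n)
    where
    add-G : G + (B * G + 0) ≡ suc B * G + 0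
    add-G = solve (B ∷ G ∷ [])
  normalForm⇒Combination zero (suc B) (suc y) (s≤s y≤B) =
    subst (Combination gens) add-G+1 (there (there (here refl)) ∷ normalForm⇒Combination zero B y y≤B)
    where
    add-G+1 : suc G + (B * G + y) ≡ suc B * G + suc y
    add-G+1 = solve (B ∷ y ∷ G ∷ [])

triangle : ℕ → ℕ
triangle zero    = 0
triangle (suc n) = triangle n + suc n

sumTrianglePairs : ℕ → ℕ
sumTrianglePairs zero    = 0
sumTrianglePairs (suc j) = sumTrianglePairs j + (triangle (suc j) + triangle (suc (suc j)))

2*triangle : ∀ n → 2 * triangle n ≡ n * suc n
2*triangle zero    = refl
2*triangle (suc n) = begin
  2 * (triangle n + suc n)        ≡⟨ *-distribˡ-+ 2 (triangle n) (suc n) ⟩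
  2 * triangle n + 2 * suc n      ≡⟨ cong (_+ 2 * suc n) (2*triangle n) ⟩
  n * suc n + 2 * suc n           ≡⟨ step n ⟩
  suc n * suc (suc n)             ∎
  where
  open ≡-Reasoning
  step : ∀ n → n * suc n + 2 * suc n ≡ suc n * suc (suc n)
  step = solve-∀

6*sumTrianglePairs : ∀ j → 6 * sumTrianglePairs j + 6 ≡ suc j * suc (suc j) * (2 * j + 3)
6*sumTrianglePairs zero    = refl
6*sumTrianglePairs (suc j) = begin
  6 * (s + (t₁ + t₂)) + 6                 ≡⟨ regroup s t₁ t₂ ⟩
  (6 * s + 6) + 3 * (2 * t₁) + 3 * (2 * t₂)
    ≡⟨ cong₂ (λ x y → x + 3 * y)
             (cong₂ (λ x y → x + 3 * y) (6*sumTrianglePairs j) (2*triangle (suc j)))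
             (2*triangle (suc (suc j))) ⟩
  suc j * suc (suc j) * (2 * j + 3) + 3 * (suc j * suc (suc j)) + 3 * (suc (suc j) * suc (suc (suc j)))
                                          ≡⟨ step j ⟩
  suc (suc j) * suc (suc (suc j)) * (2 * suc j + 3) ∎
  where
  open ≡-Reasoning
  s t₁ t₂ : ℕ
  s  = sumTrianglePairs j
  t₁ = triangle (suc j)
  t₂ = triangle (suc (suc j))
  regroup : ∀ s a b → 6 * (s + (a + b)) + 6 ≡ (6 * s + 6) + 3 * (2 * a) + 3 * (2 * b)
  regroup = solve-∀
  step : ∀ j → suc j * suc (suc j) * (2 * j + 3) + 3 * (suc j * suc (suc j)) + 3 * (suc (suc j) * suc (suc (suc j)))
             ≡ suc (suc j) * suc (suc (suc j)) * (2 * suc j + 3)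
  step = solve-∀

-- Identities for FamilyS with D left free, since the ring solver does not unfold FamilyS's
-- definitions: suc u * D + 2 stands for M and (suc u * D + 2) + (u * D + 2) for G.
frobenius-residue-identity : ∀ x u → suc (x + 3) + (u + 2) ≡ x + u + 6
frobenius-residue-identity = solve-∀

2[1+u]≡1+[2u+1] : ∀ u → 2 * suc u ≡ suc (2 * u + 1)
2[1+u]≡1+[2u+1] = solve-∀

[2u+1]M+M≡2[1+u]M : ∀ u M → (2 * u + 1) * M + M ≡ 2 * suc u * M
[2u+1]M+M≡2[1+u]M = solve-∀

2[1+j]M≡[1+2j]M+M : ∀ j M → 2 * suc j * M ≡ suc (2 * j) * M + M
2[1+j]M≡[1+2j]M+M = solve-∀


interval-identity : ∀ u D a b j y → b + j ≡ u →
  a * (suc u * D + 2) + suc b * ((suc u * D + 2) + (u * D + 2)) + y ≡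
  (a + 2 * b + 1) * (suc u * D + 2) + (j * D + 2 + y)
interval-identity .(b + j) D a b j y refl = solve (a ∷ b ∷ j ∷ D ∷ y ∷ [])

extra-identity : ∀ u D y →
  suc (suc u) * ((suc u * D + 2) + (u * D + 2)) + y ≡ 2 * suc u * (suc u * D + 2) + (u * D + 4 + y)
extra-identity = solve-∀

beyond-identity₁ : ∀ u D a k y →
  suc a * (suc u * D + 2) + (suc (suc u) + k) * ((suc u * D + 2) + (u * D + 2)) + y ≡
  (2 * suc u + 1) * (suc u * D + 2) +
  (u * D + 4 + (a * (suc u * D + 2) + k * ((suc u * D + 2) + (u * D + 2)) + y))
beyond-identity₁ = solve-∀

beyond-identity₂ : ∀ u D k y →
  (suc (suc u) + suc k) * ((suc u * D + 2) + (u * D + 2)) + y ≡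
  (2 * suc u + 1) * (suc u * D + 2) + (2 * u * D + 6 + (k * ((suc u * D + 2) + (u * D + 2)) + y))
beyond-identity₂ = solve-∀

interval-end-identity : ∀ b j D′ → (b + j) * suc D′ + 3 ≡ j * suc D′ + 2 + suc b + b * D′
interval-end-identity = solve-∀

top<W-identity : ∀ x u → suc (x + 3) + (u + 3) ≡ x + u + 7
top<W-identity = solve-∀

block-index-identity : ∀ a b → suc (a + 2 * b + 1) ≡ 2 * suc b + a
block-index-identity = solve-∀

extra-end-identity : ∀ x u → suc (x + 4 + suc (suc u)) ≡ x + u + 7
extra-end-identity = solve-∀

M≡W+τ-identity : ∀ u τ → suc u * (suc u + 4 + τ) + 2 ≡ u * (suc u + 4 + τ) + u + 7 + τ
M≡W+τ-identity = solve-∀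

-- The paper's m, g and c for p = 2 * suc u, with G = 2M − D and C = 2hM − τ written without
-- subtraction; W = M − τ is the part of block 2h − 1 below C.
module FamilyS (u τ : ℕ) where

  h : ℕ
  h = suc u

  D : ℕ
  D = h + 4 + τ

  M : ℕ
  M = h * D + 2

  G : ℕ
  G = M + (u * D + 2)

  W : ℕ
  W = u * D + u + 7

  C : ℕ
  C = (2 * u + 1) * M + W

  open ThreeGenerators M G public

  M≡W+τ : M ≡ W + τ
  M≡W+τ = M≡W+τ-identity u τ

  W≤M : W ≤ M
  W≤M = ≤-trans (m≤m+n W τ) (≤-reflexive (sym M≡W+τ))

  top<W : u * D + 3 < W
  top<W = ≤-trans (s≤s (m≤m+n (u * D + 3) (u + 3))) (≤-reflexive (top<W-identity (u * D) u))

  top<M : u * D + 3 < M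
  top<M = <-≤-trans top<W W≤M

  0<M : 0 < M
  0<M = <-≤-trans z<s top<M

  instance
    M-nonZero : NonZero M
    M-nonZero = >-nonZero 0<M

  -- B copies of G or G + 1 contribute the residues [lo B, lo B + B] to block 2B − 1 and beyond.
  lo : ℕ → ℕ
  lo B = (h ∸ B) * D + 2

  lo-≡ : ∀ {B j} → B + j ≡ h → lo B ≡ j * D + 2
  lo-≡ {B} {j} e = cong (λ x → x * D + 2) (trans (cong (_∸ B) (sym e)) (m+n∸m≡n B j))

  interval : ℕ → ℕ → Bool
  interval B = inInterval (lo B) B

  interval-end : ∀ {B} → 1 ≤ B → B ≤ h → lo B + B ≤ u * D + 3
  interval-end {suc b} _ B≤h = begin
    lo (suc b) + suc b                  ≡⟨ cong (_+ suc b) (lo-≡ {suc b} {j} (cong suc b+j≡u)) ⟩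
    j * D + 2 + suc b                   ≤⟨ m≤m+n _ (b * (u + 4 + τ)) ⟩
    j * D + 2 + suc b + b * (u + 4 + τ) ≡⟨ subst (λ v → v * D + 3 ≡ j * D + 2 + suc b + b * (u + 4 + τ))
                                                  b+j≡u (interval-end-identity b j (u + 4 + τ)) ⟨
    u * D + 3                           ∎
    where
    open ≤-Reasoning
    j : ℕ
    j = u ∸ b
    b+j≡u : b + j ≡ u
    b+j≡u = m+[n∸m]≡n (≤-pred B≤h)

  interval-top : ∀ {B r} → 1 ≤ B → B ≤ h → T (interval B r) → r ≤ u * D + 3
  interval-top {B} 1≤B B≤h t = ≤-trans (proj₂ (to (T-inInterval {lo B} {B}) t)) (interval-end 1≤B B≤h)

  -- Consecutive intervals are separated because the gap D exceeds their lengths.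
  interval-gap : ∀ β → suc β ≤ h → lo (suc β) + suc β < lo β
  interval-gap β sβ≤h = begin-strict
    lo (suc β) + suc β    ≡⟨ cong (_+ suc β) (lo-≡ {suc β} {j} sβ+j≡h) ⟩
    j * D + 2 + suc β     ≡⟨ +-comm (j * D + 2) (suc β) ⟩
    suc β + (j * D + 2)   <⟨ +-monoˡ-< (j * D + 2) sβ<D ⟩
    D + (j * D + 2)       ≡⟨ +-assoc D (j * D) 2 ⟨
    suc j * D + 2         ≡⟨ lo-≡ {β} {suc j} (trans (+-suc β j) sβ+j≡h) ⟨
    lo β                  ∎
    where
    open ≤-Reasoning
    j : ℕ
    j = h ∸ suc β
    sβ+j≡h : suc β + j ≡ h
    sβ+j≡h = m+[n∸m]≡n sβ≤h
    sβ<D : suc β < D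
    sβ<D = ≤-<-trans sβ≤h (≤-trans (m<m+n h z<s) (m≤m+n (h + 4) τ))

  lo-antitone : ∀ {B β} → B ≤ β → lo β ≤ lo B
  lo-antitone B≤β = +-monoˡ-≤ 2 (*-monoˡ-≤ D (∸-monoʳ-≤ h B≤β))

  residues : ℕ → ℕ → Bool
  residues zero      = inInterval 0 0
  residues (suc β) r = residues β r ∨ interval (suc β) r

  T-residues : ∀ β r → T (residues β r) → r ≡ 0 ⊎ ∃[ B ] 1 ≤ B × B ≤ β × T (interval B r)
  T-residues zero    r t = inj₁ (n≤0⇒n≡0 (proj₂ (to (T-inInterval {0} {0}) t)))
  T-residues (suc β) r t with to T-∨ t
  ... | inj₂ i = inj₂ (suc β , s≤s z≤n , ≤-refl , i)
  ... | inj₁ t′ with T-residues β r t′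
  ...   | inj₁ r≡0                 = inj₁ r≡0
  ...   | inj₂ (B , 1≤B , B≤β , i) = inj₂ (B , 1≤B , m≤n⇒m≤1+n B≤β , i)

  residues-origin : ∀ β → T (residues β 0)
  residues-origin zero    = tt
  residues-origin (suc β) = from T-∨ (inj₁ (residues-origin β))

  residues-interval : ∀ {β B r} → 1 ≤ B → B ≤ β → T (interval B r) → T (residues β r)
  residues-interval {zero}  (s≤s _) ()
  residues-interval {suc β} 1≤B B≤sβ i with m≤n⇒m<n∨m≡n B≤sβ
  ... | inj₂ refl = from T-∨ (inj₂ i)
  ... | inj₁ B<sβ = from T-∨ (inj₁ (residues-interval 1≤B (≤-pred B<sβ) i))

  residues-top : ∀ {β r} → β ≤ h → T (residues β r) → r ≤ u * D + 3
  residues-top {β} {r} β≤h t with T-residues β r t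
  ... | inj₁ refl                = z≤n
  ... | inj₂ (B , 1≤B , B≤β , i) = interval-top 1≤B (≤-trans B≤β β≤h) i

  residues-bottom : ∀ {β r} → T (residues β r) → r ≡ 0 ⊎ lo β ≤ r
  residues-bottom {β} {r} t with T-residues β r t
  ... | inj₁ r≡0                 = inj₁ r≡0
  ... | inj₂ (B , _ , B≤β , i) = inj₂ (≤-trans (lo-antitone B≤β) (proj₁ (to (T-inInterval {lo B} {B}) i)))

  residues-disjoint : ∀ {β r} → suc β ≤ h → T (residues β r) → ¬ T (interval (suc β) r)
  residues-disjoint {β} {r} sβ≤h t i with residues-bottom {β} {r} t | to (T-inInterval {lo (suc β)} {suc β} {r}) i
  ... | inj₁ refl  | lo≤0 , _ = <⇒≱ (<-≤-trans z<s (m≤n+m 2 _)) lo≤0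
  ... | inj₂ lo≤r  | _ , r≤   = <⇒≱ (interval-gap β sβ≤h) (≤-trans lo≤r r≤)

  count-residues : ∀ β N → β ≤ h → u * D + 3 < N → countUpTo (residues β) N ≡ triangle (suc β)
  count-residues zero    N _   top<N = countUpTo-inInterval 0 0 N (<-≤-trans z<s top<N)
  count-residues (suc β) N sβ≤h top<N =
    trans (countUpTo-∨ (residues β) (interval (suc β)) N (λ _ _ → residues-disjoint sβ≤h))
          (cong₂ _+_ (count-residues β N (≤-trans (n≤1+n β) sβ≤h) top<N)
                     (countUpTo-inInterval (lo (suc β)) (suc β) N
                        (≤-<-trans (interval-end (s≤s z≤n) sβ≤h) top<N)))

  -- The residues contributed to block 2h by h + 1 copies of G or G + 1.
  extraInterval : ℕ → Bool
  extraInterval = inInterval (u * D + 4) (suc h)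

  extra-end : u * D + 4 + suc h < W
  extra-end = ≤-reflexive (extra-end-identity (u * D) u)

  data BlockResidue (q r : ℕ) : Set where
    origin : r ≡ 0 → BlockResidue q r
    inside : ∀ B → 1 ≤ B → B ≤ h → 2 * B ≤ suc q → T (interval B r) → BlockResidue q r
    extra  : q ≡ 2 * h → T (extraInterval r) → BlockResidue q r

  too-big : ∀ {q r} → r < M → q ≤ 2 * h → ∀ X → q * M + r ≢ (2 * h + 1) * M + X
  too-big {q} {r} r<M q≤2h X e = <⇒≱ (begin-strict
    q * M + r          <⟨ +-monoʳ-< (q * M) r<M ⟩
    q * M + M          ≡⟨ +-comm (q * M) M ⟩
    suc q * M          ≤⟨ *-monoˡ-≤ M (≤-trans (s≤s q≤2h) (≤-reflexive (+-comm 1 (2 * h)))) ⟩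
    (2 * h + 1) * M    ≤⟨ m≤m+n _ X ⟩
    (2 * h + 1) * M + X ∎) (≤-reflexive (sym e))
    where open ≤-Reasoning

  residue-sound-B>h : ∀ {q r} → r < M → q ≤ 2 * h → ∀ a k y → y ≤ suc h + k →
             q * M + r ≡ a * M + (suc h + k) * G + y → BlockResidue q r
  residue-sound-B>h r<M q≤2h zero zero y y≤ e =
    let (q≡ , r≡) = quotient-unique _ _ (2 * h) (u * D + 4 + y) r<M rem<M
                      (trans e (trans (cong (λ B → B * G + y) (+-identityʳ (suc h))) (extra-identity u D y)))
    in extra q≡ (subst (T ∘ extraInterval) (sym r≡)
                  (from T-inInterval (m≤m+n (u * D + 4) y , +-monoʳ-≤ (u * D + 4) y≤h+1)))
    where
    y≤h+1 : y ≤ suc h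
    y≤h+1 = ≤-trans y≤ (≤-reflexive (+-identityʳ (suc h)))
    rem<M : u * D + 4 + y < M
    rem<M = ≤-<-trans (+-monoʳ-≤ (u * D + 4) y≤h+1)
              (<-≤-trans extra-end W≤M)
  residue-sound-B>h r<M q≤2h (suc a) k y _ e = ⊥-elim (too-big r<M q≤2h _ (trans e (beyond-identity₁ u D a k y)))
  residue-sound-B>h r<M q≤2h zero (suc k) y _ e = ⊥-elim (too-big r<M q≤2h _ (trans e (beyond-identity₂ u D k y)))

  residue-sound : ∀ {q r} → r < M → q ≤ 2 * h → Combination gens (q * M + r) → BlockResidue q r
  residue-sound {q} {r} r<M q≤2h c with Combination⇒normalForm c
  ... | a , zero , .0 , z≤n , e =
    origin (proj₂ (quotient-unique q r a 0 r<M 0<M (trans e (+-identityʳ (a * M + 0)))))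
  ... | a , suc b , y , y≤B , e with b ≤? u
  ...   | no  b≰u = residue-sound-B>h r<M q≤2h a k y (subst (y ≤_) (sym B≡) y≤B)
                      (subst (λ B → q * M + r ≡ a * M + B * G + y) (sym B≡) e)
    where
    k : ℕ
    k = b ∸ h
    B≡ : suc h + k ≡ suc b
    B≡ = cong suc (m+[n∸m]≡n (≰⇒> b≰u))
  ...   | yes b≤u =
    let (q≡ , r≡) = quotient-unique q r (a + 2 * b + 1) (j * D + 2 + y) r<M rem<M
                      (trans e (interval-identity u D a b j y b+j≡u))
    in inside (suc b) (s≤s z≤n) (s≤s b≤u)
              (≤-trans (m≤m+n (2 * suc b) a)
                       (≤-reflexive (trans (sym (block-index-identity a b)) (cong suc (sym q≡)))))
              (subst (T ∘ interval (suc b)) (sym r≡)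
                 (subst (λ L → T (inInterval L (suc b) (j * D + 2 + y))) (sym lo≡)
                    (from T-inInterval (m≤m+n (j * D + 2) y , +-monoʳ-≤ (j * D + 2) y≤B))))
    where
    j : ℕ
    j = u ∸ b
    b+j≡u : b + j ≡ u
    b+j≡u = m+[n∸m]≡n b≤u
    lo≡ : lo (suc b) ≡ j * D + 2
    lo≡ = lo-≡ {suc b} {j} (cong suc b+j≡u)
    rem<M : j * D + 2 + y < M
    rem<M = ≤-<-trans (+-monoʳ-≤ (j * D + 2) y≤B)
              (≤-<-trans (≤-reflexive (cong (_+ suc b) (sym lo≡)))
                         (≤-<-trans (interval-end (s≤s z≤n) (s≤s b≤u)) top<M))

  residue-complete : ∀ {q r} → BlockResidue q r → Combination gens (q * M + r)
  residue-complete {q} (origin refl) =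
    subst (Combination gens) (+-identityʳ (q * M + 0)) (normalForm⇒Combination q 0 0 z≤n)
  residue-complete {q} {r} (inside (suc b) _ B≤h 2B≤ i) =
    let (y , r≡ , y≤B) = split-at {j * D + 2} {suc b} {r}
                           (subst (_≤ r) lo≡ (proj₁ bounds)) (subst (λ L → r ≤ L + suc b) lo≡ (proj₂ bounds))
    in subst (Combination gens)
         (trans (interval-identity u D a b j y b+j≡u) (cong₂ _+_ (cong (_* M) q≡) (sym r≡)))
         (normalForm⇒Combination a (suc b) y y≤B)
    where
    bounds : lo (suc b) ≤ r × r ≤ lo (suc b) + suc b
    bounds = to T-inInterval i
    j : ℕ
    j = u ∸ b
    b+j≡u : b + j ≡ u
    b+j≡u = m+[n∸m]≡n (≤-pred B≤h)
    lo≡ : lo (suc b) ≡ j * D + 2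
    lo≡ = lo-≡ {suc b} {j} (cong suc b+j≡u)
    a : ℕ
    a = suc q ∸ 2 * suc b
    q≡ : a + 2 * b + 1 ≡ q
    q≡ = suc-injective (trans (block-index-identity a b) (trans (+-comm (2 * suc b) a) (m∸n+n≡m 2B≤)))
  residue-complete {r = r} (extra refl i) =
    let (lo≤r , r≤) = to T-inInterval i
        (y , r≡ , y≤) = split-at {u * D + 4} {suc h} {r} lo≤r r≤
    in subst (Combination gens) (trans (extra-identity u D y) (cong (λ x → 2 * h * M + x) (sym r≡)))
         (normalForm⇒Combination 0 (suc h) y y≤)

  -- β = ⌈q/2⌉
  T-Rep-block : ∀ {q β r} → r < M → q < 2 * h → 2 * β ≤ suc q → suc q ≤ suc (2 * β) → β ≤ h →
                T (Rep gens (q * M + r)) ⇔ T (residues β r)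
  T-Rep-block {q} {β} {r} r<M q<2h 2β≤ ≤2β+1 β≤h = mk⇔
    (λ t → present (residue-sound r<M (<⇒≤ q<2h) (Rep-sound t)))
    (λ t → Rep-complete (residue-complete (absent (T-residues β r t))))
    where
    present : BlockResidue q r → T (residues β r)
    present (origin refl)              = residues-origin β
    present (inside B 1≤B _ 2B≤ i)    = residues-interval {β} 1≤B (half-≤ (≤-trans 2B≤ ≤2β+1)) i
    present (extra q≡2h _)             = contradiction q≡2h (<⇒≢ q<2h)
    absent : r ≡ 0 ⊎ ∃[ B ] 1 ≤ B × B ≤ β × T (interval B r) → BlockResidue q r
    absent (inj₁ r≡0)                 = origin r≡0
    absent (inj₂ (B , 1≤B , B≤β , i)) =
      inside B 1≤B (≤-trans B≤β β≤h) (≤-trans (*-monoʳ-≤ 2 B≤β) 2β≤) i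

  T-Rep-last-block : ∀ {r} → r < M → T (Rep gens (2 * h * M + r)) ⇔ T (residues h r ∨ extraInterval r)
  T-Rep-last-block {r} r<M = mk⇔
    (λ t → from T-∨ (present (residue-sound r<M ≤-refl (Rep-sound t))))
    (λ t → Rep-complete (residue-complete (absent (to T-∨ t))))
    where
    present : BlockResidue (2 * h) r → T (residues h r) ⊎ T (extraInterval r)
    present (origin refl)           = inj₁ (residues-origin h)
    present (inside B 1≤B B≤h _ i)  = inj₁ (residues-interval 1≤B B≤h i)
    present (extra _ i)             = inj₂ i
    absent : T (residues h r) ⊎ T (extraInterval r) → BlockResidue (2 * h) r
    absent (inj₂ i) = extra refl i
    absent (inj₁ t) with T-residues h r t
    ... | inj₁ r≡0                 = origin r≡0
    ... | inj₂ (B , 1≤B , B≤h , i) = inside B 1≤B B≤h (≤-trans (*-monoʳ-≤ 2 B≤h) (n≤1+n _)) i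

  count-block : ∀ {q β} → q < 2 * h → 2 * β ≤ suc q → suc q ≤ suc (2 * β) → β ≤ h →
                countUpTo (λ r → Rep gens (q * M + r)) M ≡ triangle (suc β)
  count-block q<2h 2β≤ ≤2β+1 β≤h =
    trans (countUpTo-cong M (λ r r<M → T-Rep-block r<M q<2h 2β≤ ≤2β+1 β≤h)) (count-residues _ M β≤h top<M)

  M≤[2u+1]M : M ≤ (2 * u + 1) * M
  M≤[2u+1]M = ≤-trans (≤-reflexive (sym (*-identityˡ M))) (*-monoˡ-≤ M (m≤n+m 1 (2 * u)))

  M≤C : M ≤ C
  M≤C = ≤-trans M≤[2u+1]M (m≤m+n ((2 * u + 1) * M) W)

  gens-≥M : ∀ {a} → a ∈ gens → M ≤ a
  gens-≥M (here refl)                 = ≤-refl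
  gens-≥M (there (here refl))         = m≤m+n M _
  gens-≥M (there (there (here refl))) = m≤n⇒m≤1+n (m≤m+n M _)

  G+1≡ : suc G ≡ M + (u * D + 3)
  G+1≡ = sym (trans (cong (λ x → M + x) (+-suc (u * D) 2)) (+-suc M (u * D + 2)))

  gens<2M : ∀ {a} → a ∈ gens → a < M + M
  gens<2M (here refl)                 = m<m+n M 0<M
  gens<2M (there (here refl))         = +-monoʳ-< M (<-trans (+-monoʳ-< (u * D) (n<1+n 2)) top<M)
  gens<2M (there (there (here refl))) = subst (_< M + M) (sym G+1≡) (+-monoʳ-< M top<M)

  G+1<C : suc G < C
  G+1<C = subst (_< C) (sym G+1≡)
    (<-≤-trans (+-monoʳ-< M top<W) (+-monoˡ-≤ W M≤[2u+1]M))

  gens<C : ∀ {a} → a ∈ gens → a < C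
  gens<C (here refl)                 = <-trans (≤-<-trans (m≤m+n M _) (n<1+n G)) G+1<C
  gens<C (there (here refl))         = <-trans (n<1+n G) G+1<C
  gens<C (there (there (here refl))) = G+1<C

  open GeneratedSemigroup gens C M 0<M M≤C gens-≥M
  open AboveConductor gens<C

  C+τ≡2hM : C + τ ≡ 2 * h * M
  C+τ≡2hM = trans (+-assoc ((2 * u + 1) * M) W τ)
              (trans (cong (λ x → (2 * u + 1) * M + x) (sym M≡W+τ)) ([2u+1]M+M≡2[1+u]M u M))

  T-Rep-last-odd-block : ∀ {r} → r < M → T (Rep gens ((2 * u + 1) * M + r)) ⇔ T (residues h r)
  T-Rep-last-odd-block r<M =
    T-Rep-block r<M (≤-reflexive (sym (2[1+u]≡1+[2u+1] u))) (≤-reflexive (2[1+u]≡1+[2u+1] u))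
                (≤-trans (≤-reflexive (sym (2[1+u]≡1+[2u+1] u))) (n≤1+n _)) ≤-refl

  above-last-odd-block : ∀ {r} → u * D + 3 < r → r < M → ¬ T (Rep gens ((2 * u + 1) * M + r))
  above-last-odd-block top<r r<M t = <⇒≱ top<r (residues-top ≤-refl (to (T-Rep-last-odd-block r<M) t))

  frobenius : ℕ
  frobenius = (2 * u + 1) * M + (u * D + u + 6)

  C≡1+frobenius : C ≡ suc frobenius
  C≡1+frobenius = trans (cong (λ x → (2 * u + 1) * M + x) (+-suc (u * D + u) 6)) (+-suc ((2 * u + 1) * M) _)

  cS≡C : cS S C ≡ C
  cS≡C = trans (cong (conductor S) C≡1+frobenius)
    (trans (conductor-≡ S frobenius frobenius∉S) (sym C≡1+frobenius))
    where
    frobenius∉S : ¬ T (S frobenius)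
    frobenius∉S t = above-last-odd-block
      (≤-trans (m≤m+n (suc (u * D + 3)) (u + 2)) (≤-reflexive (frobenius-residue-identity (u * D) u)))
      (<-≤-trans (+-monoʳ-< (u * D + u) (n<1+n 6)) W≤M)
      (Rep-complete (to (T-S-below (subst (frobenius <_) (sym C≡1+frobenius) (n<1+n frobenius))) t))

  mS≡M : mS S C ≡ M
  mS≡M = multiplicity-S (here refl)

  qS≡2h : qS S C ≡ 2 * h
  qS≡2h = trans (cong₂ ceilDiv cS≡C mS≡M)
    (trans (ceilDiv-≡ C M (2 * u + 1) 0<M (m<m+n _ (<-≤-trans z<s top<W))
              (≤-trans (m≤m+n C τ) (≤-reflexive (trans C+τ≡2hM (cong (_* M) (2[1+u]≡1+[2u+1] u))))))
           (sym (2[1+u]≡1+[2u+1] u)))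

  ρS≡τ : ρS S C ≡ + τ
  ρS≡τ = begin
    + (qS S C * mS S C) ℤ.- + cS S C
      ≡⟨ cong₂ (λ x y → + x ℤ.- + y) (trans (cong₂ _*_ qS≡2h mS≡M) (sym C+τ≡2hM)) cS≡C ⟩
    + (C + τ) ℤ.- + C                 ≡⟨ ℤP.[+m]-[+n]≡m⊖n (C + τ) C ⟩
    (C + τ) ℤ.⊖ C                     ≡⟨ ℤP.⊖-≥ (m≤m+n C τ) ⟩
    + (C + τ ∸ C)                     ≡⟨ cong +_ (m+n∸m≡n C τ) ⟩
    + τ                               ∎
    where open ≡-Reasoning

  tail-gap : ∀ i → i < τ → ¬ T (Rep gens (C + i))
  tail-gap i i<τ t = above-last-odd-block (<-≤-trans top<W (m≤m+n W i))
    (subst (W + i <_) (sym M≡W+τ) (+-monoʳ-< W i<τ))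
    (subst (T ∘ Rep gens) (+-assoc ((2 * u + 1) * M) W i) t)

  count-pairs : ∀ j → j ≤ h → countUpTo (Rep gens) (2 * j * M) ≡ sumTrianglePairs j
  count-pairs zero    _     = refl
  count-pairs (suc j) sj≤h = begin
    countUpTo R (2 * suc j * M)
      ≡⟨ cong (countUpTo R) (2[1+j]M≡[1+2j]M+M j M) ⟩
    countUpTo R (suc (2 * j) * M + M)
      ≡⟨ countUpTo-+ R (suc (2 * j) * M) M ⟩
    countUpTo R (suc (2 * j) * M) + countUpTo (λ r → R (suc (2 * j) * M + r)) M
      ≡⟨ cong₂ _+_ (trans (cong (countUpTo R) (+-comm M (2 * j * M))) (countUpTo-+ R (2 * j * M) M)) odd-block ⟩
    (countUpTo R (2 * j * M) + countUpTo (λ r → R (2 * j * M + r)) M) + triangle (suc (suc j))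
      ≡⟨ cong₂ (λ x y → (x + y) + triangle (suc (suc j)))
               (count-pairs j (≤-trans (n≤1+n j) sj≤h)) even-block ⟩
    (sumTrianglePairs j + triangle (suc j)) + triangle (suc (suc j))
      ≡⟨ +-assoc (sumTrianglePairs j) _ _ ⟩
    sumTrianglePairs (suc j) ∎
    where
    open ≡-Reasoning
    R : ℕ → Bool
    R = Rep gens
    2j<2h : 2 * j < 2 * h
    2j<2h = *-monoʳ-< 2 sj≤h
    even-block : countUpTo (λ r → R (2 * j * M + r)) M ≡ triangle (suc j)
    even-block = count-block 2j<2h (n≤1+n _) ≤-refl (≤-trans (n≤1+n j) sj≤h)
    odd-block : countUpTo (λ r → R (suc (2 * j) * M + r)) M ≡ triangle (suc (suc j))
    odd-block = count-block (≤-trans (≤-reflexive (sym (double-suc j))) (*-monoʳ-≤ 2 sj≤h))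
      (≤-reflexive (double-suc j)) (≤-trans (≤-reflexive (sym (double-suc j))) (n≤1+n _)) sj≤h

  cardL≡ : cardL S C ≡ sumTrianglePairs h
  cardL≡ = begin
    count S (range 0 (cS S C))          ≡⟨ cong (λ c → count S (range 0 c)) cS≡C ⟩
    count S (range 0 C)                 ≡⟨ count-range S 0 C ⟩
    countUpTo S C                       ≡⟨ countUpTo-cong C (λ n n<C → ≡⇒T⇔ (S≡Rep-below n<C)) ⟩
    countUpTo (Rep gens) C              ≡⟨ +-identityʳ _ ⟨
    countUpTo (Rep gens) C + 0          ≡⟨ cong (λ x → countUpTo (Rep gens) C + x) (countUpTo-none _ τ tail-gap) ⟨
    countUpTo (Rep gens) C + countUpTo (λ i → Rep gens (C + i)) τ ≡⟨ countUpTo-+ (Rep gens) C τ ⟨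
    countUpTo (Rep gens) (C + τ)        ≡⟨ cong (countUpTo (Rep gens)) C+τ≡2hM ⟩
    countUpTo (Rep gens) (2 * h * M)    ≡⟨ count-pairs h ≤-refl ⟩
    sumTrianglePairs h                  ∎
    where open ≡-Reasoning

  isGenerator : ℕ → Bool
  isGenerator n = inInterval M 0 n ∨ inInterval G 1 n

  T-isGenerator : ∀ {n} → T (isGenerator n) ⇔ n ∈ gens
  T-isGenerator {n} = mk⇔ to′ from′
    where
    to′ : T (isGenerator n) → n ∈ gens
    to′ t with to T-∨ t
    ... | inj₁ t′ = let (M≤n , n≤M) = to (T-inInterval {M} {0} {n}) t′ in
      here (≤-antisym (≤-trans n≤M (≤-reflexive (+-identityʳ M))) M≤n)
    ... | inj₂ t′ with to (T-inInterval {G} {1} {n}) t′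
    ...   | G≤n , n≤G+1 with m≤n⇒m<n∨m≡n G≤n
    ...     | inj₂ G≡n = there (here (sym G≡n))
    ...     | inj₁ G<n = there (there (here (≤-antisym (≤-trans n≤G+1 (≤-reflexive (+-comm G 1))) G<n)))
    from′ : n ∈ gens → T (isGenerator n)
    from′ (here refl)                 = from T-∨ (inj₁ (from T-inInterval (≤-refl , m≤m+n M 0)))
    from′ (there (here refl))         = from T-∨ (inj₂ (from T-inInterval (≤-refl , m≤m+n G 1)))
    from′ (there (there (here refl))) = from T-∨ (inj₂ (from T-inInterval (n≤1+n G , ≤-reflexive (+-comm 1 G))))

  cardPL≡3 : cardPL S C ≡ 3
  cardPL≡3 = begin
    count (isMinGen S) (range 0 (cS S C))   ≡⟨ cong (λ c → count (isMinGen S) (range 0 c)) cS≡C ⟩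
    count (isMinGen S) (range 0 C)          ≡⟨ count-range (isMinGen S) 0 C ⟩
    countUpTo (isMinGen S) C                ≡⟨ countUpTo-cong C minimal⇔generator ⟩
    countUpTo isGenerator C                 ≡⟨ countUpTo-∨ (inInterval M 0) (inInterval G 1) C M≠G ⟩
    countUpTo (inInterval M 0) C + countUpTo (inInterval G 1) C
      ≡⟨ cong₂ _+_ (countUpTo-inInterval M 0 C (<-trans (≤-<-trans (≤-reflexive (+-identityʳ M)) M<G)
                                                        (<-trans (n<1+n G) G+1<C)))
                   (countUpTo-inInterval G 1 C (subst (_< C) (+-comm 1 G) G+1<C)) ⟩
    3                                       ∎
    where
    open ≡-Reasoning
    M<G : M < G
    M<G = m<m+n M (<-≤-trans z<s (m≤n+m 2 (u * D)))
    minimal⇔generator : ∀ n → n < C → T (isMinGen S n) ⇔ T (isGenerator n)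
    minimal⇔generator n n<C =
      mk⇔ (from T-isGenerator ∘ to (isMinGen⇔∈ gens<2M n<C))
          (from (isMinGen⇔∈ gens<2M n<C) ∘ to T-isGenerator)
    M≠G : ∀ n → n < C → T (inInterval M 0 n) → ¬ T (inInterval G 1 n)
    M≠G n _ t t′ = <⇒≱ (≤-<-trans (≤-trans (proj₂ (to (T-inInterval {M} {0} {n}) t))
                                           (≤-reflexive (+-identityʳ M)))
                                  M<G)
                       (proj₁ (to (T-inInterval {G} {1} {n}) t′))

  cardDq≡ : cardDq S C ≡ triangle (suc h) + suc (suc h)
  cardDq≡ = begin
    count N (range (cS S C) (cS S C + mS S C))   ≡⟨ cong₂ (λ c m → count N (range c (c + m))) cS≡C mS≡M ⟩
    count N (range C (C + M))                    ≡⟨ count-range N C (C + M) ⟩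
    countUpTo (λ i → N (C + i)) (C + M ∸ C)      ≡⟨ cong (countUpTo (λ i → N (C + i))) (m+n∸m≡n C M) ⟩
    countUpTo (λ i → N (C + i)) M                ≡⟨ countUpTo-cong M non-minimal⇔Rep ⟩
    countUpTo (λ i → Rep gens (C + i)) M
      ≡⟨ cong (countUpTo (λ i → Rep gens (C + i))) (trans M≡W+τ (+-comm W τ)) ⟩
    countUpTo (λ i → Rep gens (C + i)) (τ + W)   ≡⟨ countUpTo-+ (λ i → Rep gens (C + i)) τ W ⟩
    countUpTo (λ i → Rep gens (C + i)) τ + countUpTo (λ i → Rep gens (C + (τ + i))) W
      ≡⟨ cong₂ _+_ (countUpTo-none _ τ tail-gap)
                   (countUpTo-cong W (λ i _ → ≡⇒T⇔ (cong (Rep gens) (shift i)))) ⟩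
    countUpTo (λ i → Rep gens (2 * h * M + i)) W
      ≡⟨ countUpTo-cong W (λ i i<W → T-Rep-last-block (<-≤-trans i<W W≤M)) ⟩
    countUpTo (λ i → residues h i ∨ extraInterval i) W
      ≡⟨ countUpTo-∨ (residues h) extraInterval W residues<extra ⟩
    countUpTo (residues h) W + countUpTo extraInterval W
      ≡⟨ cong₂ _+_ (count-residues h W ≤-refl top<W) (countUpTo-inInterval (u * D + 4) (suc h) W extra-end) ⟩
    triangle (suc h) + suc (suc h)               ∎
    where
    open ≡-Reasoning
    N : ℕ → Bool
    N z = not (isMinGen S z)
    non-minimal⇔Rep : ∀ i → i < M → T (N (C + i)) ⇔ T (Rep gens (C + i))
    non-minimal⇔Rep i i<M = mk⇔ (Rep-complete ∘ to (notMinGen⇔Combination (m≤m+n C i) (+-monoʳ-< C i<M)))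
                                (from (notMinGen⇔Combination (m≤m+n C i) (+-monoʳ-< C i<M)) ∘ Rep-sound)
    shift : ∀ i → C + (τ + i) ≡ 2 * h * M + i
    shift i = trans (sym (+-assoc C τ i)) (cong (_+ i) C+τ≡2hM)
    residues<extra : ∀ i → i < W → T (residues h i) → ¬ T (extraInterval i)
    residues<extra i _ t t′ = <⇒≱ (≤-<-trans (residues-top ≤-refl t) (+-monoʳ-< (u * D) (n<1+n 3)))
                                  (proj₁ (to (T-inInterval {u * D + 4} {suc h}) t′))

  Eliahou≡ : Eliahou S C ≡ (+ (3 * sumTrianglePairs h) ℤ.- + (2 * h * (triangle (suc h) + suc (suc h)))) ℤ.+ + τ
  Eliahou≡ =
    cong₂ ℤ._+_ (cong₂ (λ a b → + a ℤ.- + b) (cong₂ _*_ cardPL≡3 cardL≡) (cong₂ _*_ qS≡2h cardDq≡)) ρS≡τ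

-- 8 E = p (2 − p) + 8τ for E = 3 |L| − 2h |D_q| + τ and p = h * 2, with both sides moved so
-- that no subtraction occurs.
8*Eliahou-ℕ : ∀ h → 8 * (3 * sumTrianglePairs h) + (h * 2) * (h * 2) ≡
                    2 * (h * 2) + 8 * (2 * h * (triangle (suc h) + suc (suc h)))
8*Eliahou-ℕ h = +-cancelʳ-≡ 24 _ _ (begin
  8 * (3 * L) + p * p + 24                                 ≡⟨ lhs h L ⟩
  4 * (6 * L + 6) + p * p                                  ≡⟨ cong (λ x → 4 * x + p * p) (6*sumTrianglePairs h) ⟩
  4 * (suc h * suc (suc h) * (2 * h + 3)) + p * p          ≡⟨ middle h ⟩
  2 * p + 8 * h * (suc h * suc (suc h)) + 16 * h * suc (suc h) + 24
    ≡⟨ cong (λ x → 2 * p + 8 * h * x + 16 * h * suc (suc h) + 24) (2*triangle (suc h)) ⟨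
  2 * p + 8 * h * (2 * t) + 16 * h * suc (suc h) + 24      ≡⟨ rhs h t ⟨
  2 * p + 8 * (2 * h * (t + suc (suc h))) + 24             ∎)
  where
  open ≡-Reasoning
  p L t : ℕ
  p = h * 2
  L = sumTrianglePairs h
  t = triangle (suc h)
  lhs : ∀ h L → 8 * (3 * L) + (h * 2) * (h * 2) + 24 ≡ 4 * (6 * L + 6) + (h * 2) * (h * 2)
  lhs = solve-∀
  middle : ∀ h → 4 * (suc h * suc (suc h) * (2 * h + 3)) + (h * 2) * (h * 2) ≡
                 2 * (h * 2) + 8 * h * (suc h * suc (suc h)) + 16 * h * suc (suc h) + 24
  middle = solve-∀
  rhs : ∀ h t → 2 * (h * 2) + 8 * (2 * h * (t + suc (suc h))) + 24 ≡
                2 * (h * 2) + 8 * h * (2 * t) + 16 * h * suc (suc h) + 24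
  rhs = solve-∀

8*Eliahou-ℤ : ∀ A B p t → 8 * A + p * p ≡ 2 * p + 8 * B →
              + 8 ℤ.* ((+ A ℤ.- + B) ℤ.+ + t) ≡ + p ℤ.* (+ 2 ℤ.- + p) ℤ.+ + 8 ℤ.* + t
8*Eliahou-ℤ A B p t e = begin
  + 8 ℤ.* ((+ A ℤ.- + B) ℤ.+ + t)          ≡⟨ expand (+ A) (+ B) (+ p) (+ t) ⟩
  R ℤ.+ ((+ 8 ℤ.* + A ℤ.+ + p ℤ.* + p) ℤ.- X) ≡⟨ cong (λ x → R ℤ.+ (x ℤ.- X)) e-ℤ ⟩
  R ℤ.+ (X ℤ.- X)                          ≡⟨ cong (λ x → R ℤ.+ x) (ℤP.+-inverseʳ X) ⟩
  R ℤ.+ + 0                                ≡⟨ ℤP.+-identityʳ R ⟩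
  R                                        ∎
  where
  open ≡-Reasoning
  R X : ℤ
  R = + p ℤ.* (+ 2 ℤ.- + p) ℤ.+ + 8 ℤ.* + t
  X = + 2 ℤ.* + p ℤ.+ + 8 ℤ.* + B
  expand : ∀ a b p t → + 8 ℤ.* ((a ℤ.- b) ℤ.+ t) ≡
           (p ℤ.* (+ 2 ℤ.- p) ℤ.+ + 8 ℤ.* t) ℤ.+ ((+ 8 ℤ.* a ℤ.+ p ℤ.* p) ℤ.- (+ 2 ℤ.* p ℤ.+ + 8 ℤ.* b))
  expand = ℤSolver.solve-∀
  e-ℤ : + 8 ℤ.* + A ℤ.+ + p ℤ.* + p ≡ X
  e-ℤ = begin
    + 8 ℤ.* + A ℤ.+ + p ℤ.* + p ≡⟨ cong₂ ℤ._+_ (ℤP.pos-* 8 A) (ℤP.pos-* p p) ⟨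
    + (8 * A) ℤ.+ + (p * p)     ≡⟨ ℤP.pos-+ (8 * A) (p * p) ⟨
    + (8 * A + p * p)           ≡⟨ cong +_ e ⟩
    + (2 * p + 8 * B)           ≡⟨ ℤP.pos-+ (2 * p) (8 * B) ⟩
    + (2 * p) ℤ.+ + (8 * B)     ≡⟨ cong₂ ℤ._+_ (ℤP.pos-* 2 p) (ℤP.pos-* 8 B) ⟩
    X                           ∎

-- Defs spells the family with p / 2 and truncated subtraction; x stands for p / 2.
family-M : ∀ u τ x → x ≡ suc u → x * x + 2 * (suc u * 2) + 2 + τ * x ≡ FamilyS.M u τ
family-M u τ .(suc u) refl = identity u τ
  where
  identity : ∀ u τ → suc u * suc u + 2 * (suc u * 2) + 2 + τ * suc u ≡ suc u * (suc u + 4 + τ) + 2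
  identity = solve-∀

family-G : ∀ u τ x → x ≡ suc u →
           2 * (x * x + 2 * (suc u * 2) + 2) ∸ (x + 4) + τ * (suc u * 2 ∸ 1) ≡ FamilyS.G u τ
family-G u τ .(suc u) refl = begin
  2 * μ ∸ (suc u + 4) + τ * suc (u * 2)
    ≡⟨ cong (λ x → x ∸ (suc u + 4) + τ * suc (u * 2)) (2μ u) ⟩
  (2 * (suc u * suc u) + 7 * suc u) + (suc u + 4) ∸ (suc u + 4) + τ * suc (u * 2)
    ≡⟨ cong (_+ τ * suc (u * 2)) (m+n∸n≡m _ (suc u + 4)) ⟩
  2 * (suc u * suc u) + 7 * suc u + τ * suc (u * 2)
    ≡⟨ γ+τ u τ ⟩
  FamilyS.G u τ ∎
  where
  open ≡-Reasoning
  μ : ℕ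
  μ = suc u * suc u + 2 * (suc u * 2) + 2
  2μ : ∀ u → 2 * (suc u * suc u + 2 * (suc u * 2) + 2) ≡ (2 * (suc u * suc u) + 7 * suc u) + (suc u + 4)
  2μ = solve-∀
  γ+τ : ∀ u τ → 2 * (suc u * suc u) + 7 * suc u + τ * suc (u * 2) ≡
                (suc u * (suc u + 4 + τ) + 2) + (u * (suc u + 4 + τ) + 2)
  γ+τ = solve-∀

family-C : ∀ u τ x → x ≡ suc u →
           suc u * 2 * (x * x + 2 * (suc u * 2) + 2) + τ * (2 * (x * x) ∸ 1) ≡ FamilyS.C u τ
family-C u τ .(suc u) refl =
  trans (cong (λ x → suc u * 2 * (suc u * suc u + 2 * (suc u * 2) + 2) + τ * (x ∸ 1)) (2h² u)) (identity u τ)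
  where
  2h² : ∀ u → 2 * (suc u * suc u) ≡ suc (2 * u * u + 4 * u + 1)
  2h² = solve-∀
  identity : ∀ u τ → suc u * 2 * (suc u * suc u + 2 * (suc u * 2) + 2) + τ * (2 * u * u + 4 * u + 1) ≡
                     (2 * u + 1) * (suc u * (suc u + 4 + τ) + 2) + (u * (suc u + 4 + τ) + u + 7)
  identity = solve-∀

module _ (u τ : ℕ) where
  open FamilyS u τ

  half-p : (suc u * 2) / 2 ≡ suc u
  half-p = m*n/n≡m (suc u) 2

  family-gens : Family.gens (suc u * 2) τ ≡ gens
  family-gens =
    cong₂ _∷_ (family-M u τ _ half-p) (cong₂ _∷_ family-gg (cong (λ g → suc g ∷ []) family-gg))
    where
    family-gg : Family.gg (suc u * 2) τ ≡ G
    family-gg = family-G u τ _ half-p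

  E-S≡Eliahou : E-S (suc u * 2) τ ≡ Eliahou (gen gens C) C
  E-S≡Eliahou = cong₂ (λ A c → Eliahou (gen A c) c) family-gens (family-C u τ _ half-p)

  ρ-S≡ρS : ρ-S (suc u * 2) τ ≡ ρS (gen gens C) C
  ρ-S≡ρS = cong₂ (λ A c → ρS (gen A c) c) family-gens (family-C u τ _ half-p)

theorem4p7 : (p τ : ℕ) → 2 ∣ p → 0 < p →
    (E-S p τ ≡ E-S p 0 ℤ.+ ρ-S p τ)
    × (+ 8 ℤ.* E-S p τ ≡ + p ℤ.* (+ 2 ℤ.- + p) ℤ.+ + 8 ℤ.* + τ)
theorem4p7 _ τ (divides zero    refl) ()
theorem4p7 _ τ (divides (suc u) refl) _ = E-additive , E-closed-form
  where
  L Dq : ℕ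
  L  = 3 * sumTrianglePairs (suc u)
  Dq = 2 * suc u * (triangle (suc (suc u)) + suc (suc (suc u)))
  E≡ : ∀ τ → E-S (suc u * 2) τ ≡ (+ L ℤ.- + Dq) ℤ.+ + τ
  E≡ τ = trans (E-S≡Eliahou u τ) (FamilyS.Eliahou≡ u τ)
  E-additive : E-S (suc u * 2) τ ≡ E-S (suc u * 2) 0 ℤ.+ ρ-S (suc u * 2) τ
  E-additive = trans (E≡ τ) (sym (cong₂ ℤ._+_ (trans (E≡ 0) (ℤP.+-identityʳ (+ L ℤ.- + Dq)))
                                              (trans (ρ-S≡ρS u τ) (FamilyS.ρS≡τ u τ))))
  E-closed-form : + 8 ℤ.* E-S (suc u * 2) τ ≡ + (suc u * 2) ℤ.* (+ 2 ℤ.- + (suc u * 2)) ℤ.+ + 8 ℤ.* + τ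
  E-closed-form = trans (cong (+ 8 ℤ.*_) (E≡ τ)) (8*Eliahou-ℤ L Dq (suc u * 2) τ (8*Eliahou-ℕ (suc u)))
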